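{- Let $e,k$ be positive integers, $q=2^e$, and $V=\mathbb{F}_{q^{2k+1}}\times\mathbb{F}_q$, viewed as a vector space over $\mathbb{F}_q$, with vectors written $\overline{x}=(x,x_1)$, $x\in\mathbb{F}_{q^{2k+1}}$, $x_1\in\mathbb{F}_q$. Define $g:V\times V\to\mathbb{F}_{q^{2k+1}}$ by $g(\overline{x},\overline{y})=(x_1y+y_1x)^{q+1}+xy^q+x^qy$, and for a $2$-dimensional $\mathbb{F}_q$-subspace $S$ of $V$ let $g(S)=\{g(\overline{z},\overline{w}):\overline{z},\overline{w}\in S\}$. Let $\overline{x},\overline{y},\overline{z}\in V$ be nonzero vectors such that $S_1=\mathrm{span}(\overline{x},\overline{y})$ and $S_2=\mathrm{span}(\overline{x},\overline{z})$ are distinct $2$-dimensional subspaces. Then $g(S_1)\cap g(S_2)=\{0\}$.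
   Context: Equivalently, if $(a,a_1),(b,b_1)$ is any basis of $S$, then $g(S)=\{\alpha^2(a_1b+b_1a)^{q+1}+\alpha(ab^q+a^qb):\alpha\in\mathbb{F}_q\}$, which is an $e$-dimensional $\mathbb{F}_2$-subspace of $\mathbb{F}_{q^{2k+1}}\cong\mathbb{F}_2^{(2k+1)e}$. -}

module Defs where

open import Level using (Level; _⊔_)
open import Data.Nat using (ℕ; zero; suc)
import Data.Nat as ℕ
open import Data.Fin using (Fin)
open import Data.Product using (Σ; _×_; ∃; _,_)
open import Relation.Nullary using (¬_)
open import Relation.Binary.PropositionalEquality using (setoid)
open import Function.Bundles using (Bijection)
open import Algebra.Bundles using (CommutativeRing)

IsField : ∀ {c ℓ} → CommutativeRing c ℓ → Set (c ⊔ ℓ)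
IsField R = ¬ (1# ≈ 0#) × (∀ x → ¬ (x ≈ 0#) → Σ Carrier λ y → x * y ≈ 1#)
  where open CommutativeRing R

HasCardinality : ∀ {c ℓ} → CommutativeRing c ℓ → ℕ → Set (c ⊔ ℓ)
HasCardinality R N = Bijection (setoid (Fin N)) (CommutativeRing.setoid R)

module FieldNotions {c ℓ} (R : CommutativeRing c ℓ) (q : ℕ) where
  open CommutativeRing R

  infixr 8 _^_
  _^_ : Carrier → ℕ → Carrier
  x ^ zero = 1#
  x ^ suc n = x * (x ^ n)

  InFq : Carrier → Set ℓ
  InFq a = a ^ q ≈ a

  Vec2 : Set c
  Vec2 = Carrier × Carrier

  InV : Vec2 → Set ℓ
  InV (x , x₁) = InFq x₁

  _≈V_ : Vec2 → Vec2 → Set ℓ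
  (x , x₁) ≈V (y , y₁) = (x ≈ y) × (x₁ ≈ y₁)

  0V : Vec2
  0V = (0# , 0#)

  NonzeroV : Vec2 → Set ℓ
  NonzeroV v = ¬ (v ≈V 0V)

  lin : Carrier → Vec2 → Carrier → Vec2 → Vec2
  lin α (x , x₁) β (y , y₁) = (α * x + β * y , α * x₁ + β * y₁)

  InSpan : Vec2 → Vec2 → Vec2 → Set (c ⊔ ℓ)
  InSpan u v w = Σ Carrier λ α → Σ Carrier λ β →
    InFq α × InFq β × (w ≈V lin α u β v)

  LinIndep : Vec2 → Vec2 → Set (c ⊔ ℓ)
  LinIndep u v = ∀ α β → InFq α → InFq β → lin α u β v ≈V 0V → (α ≈ 0#) × (β ≈ 0#)

  SameSpan : Vec2 → Vec2 → Vec2 → Vec2 → Set (c ⊔ ℓ)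
  SameSpan u v u' v' = ∀ w → InV w → (InSpan u v w → InSpan u' v' w) × (InSpan u' v' w → InSpan u v w)

  g : Vec2 → Vec2 → Carrier
  g (x , x₁) (y , y₁) = (x₁ * y + y₁ * x) ^ (q ℕ.+ 1) + x * y ^ q + x ^ q * y

  InGSpan : Vec2 → Vec2 → Carrier → Set (c ⊔ ℓ)
  InGSpan u v t = Σ Vec2 λ z → Σ Vec2 λ w →
    InV z × InV w × InSpan u v z × InSpan u v w × (g z w ≈ t)

-- A field F of order 2^(e(2k+1)) satisfies x^|F| = x, has characteristic two, and contains no root
-- of r^q + r = 1: iterating r^q = r + 1 would give r = r^(q^(2k+1)) = r + (2k+1) = r + 1.
--
-- On a span ⟨x, y⟩ the first term of g and the form B(x, y) = x y^q + x^q y are alternating and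
-- F_q-bilinear, so g takes on ⟨x, y⟩ exactly the values g(x, D y) with D ∈ F_q. A common value t of
-- g(S₁) and g(S₂) is thus g(x, D y) = g(x, E z), and t = 0 unless D, E ≠ 0. The key claim is that
-- g(x, b) = g(x, c) forces c ∈ b + F_q x: after normalising, a failure would produce an equation
-- B(n, w) = w^(q+1) with w ≠ 0, i.e. a root n/w of r^q + r = 1. Hence E z ∈ D y + F_q x, and then
-- S₁ = S₂.
module Submission where

open import Defs
open import Level using (Level; _⊔_)
open import Data.Bool using (Bool; true; false)
import Data.Bool.Properties as Bool
open import Data.Empty using (⊥-elim)
open import Data.Fin using (Fin; punchIn)
open import Data.Fin.Permutation using (Permutation; _⟨$⟩ʳ_; remove; punchIn-permute)
open import Data.Fin.Properties using (punchInᵢ≢i; inj⇒≟)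
open import Data.Maybe using (Maybe; just; nothing)
open import Data.Nat using (ℕ; zero; suc; _≤_)
import Data.Nat as ℕ
import Data.Nat.Properties as ℕP
open import Data.Product using (Σ; _,_; proj₁; proj₂)
open import Data.Vec.Functional using (replicate)
open import Function using (_∘_)
open import Function.Bundles using (Inverse)
open import Function.Properties.Bijection using (Bijection⇒Inverse)
import Function.Properties.Inverse as ↔
open import Relation.Binary.Definitions using (Decidable)
open import Relation.Nullary using (¬_; yes; no)
import Relation.Binary.PropositionalEquality as ≡
open import Algebra.Bundles using (CommutativeRing)
import Algebra.Solver.Ring
open import Algebra.Solver.Ring.AlmostCommutativeRing
  using (fromCommutativeRing; _-Raw-AlmostCommutative⟶_)

HasCharacteristicTwo : ∀ {c ℓ} → CommutativeRing c ℓ → Set ℓ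
HasCharacteristicTwo R = 1# + 1# ≈ 0#
  where open CommutativeRing R

module Exponentiation {c ℓ} (R : CommutativeRing c ℓ) where
  open CommutativeRing R
  open import Algebra.Properties.Semiring.Exp semiring public
    using (_^_; ^-congˡ; ^-homo-*; ^-assocʳ)
  open import Algebra.Properties.CommutativeSemiring.Exp commutativeSemiring public
    using (^-distrib-*)
  open import Relation.Binary.Reasoning.Setoid setoid

  ^-agrees : ∀ q x n → FieldNotions._^_ R q x n ≡.≡ x ^ n
  ^-agrees q x zero    = ≡.refl
  ^-agrees q x (suc n) = ≡.cong (x *_) (^-agrees q x n)

  1^n≈1 : ∀ n → 1# ^ n ≈ 1#
  1^n≈1 zero    = refl
  1^n≈1 (suc n) = trans (*-identityˡ _) (1^n≈1 n)

  AdditivePower : ℕ → Set _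
  AdditivePower n = ∀ x y → (x + y) ^ n ≈ x ^ n + y ^ n

  additivePower-1 : AdditivePower 1
  additivePower-1 x y = trans (*-identityʳ (x + y)) (sym (+-cong (*-identityʳ x) (*-identityʳ y)))

  additivePower-* : ∀ {m n} → AdditivePower m → AdditivePower n → AdditivePower (m ℕ.* n)
  additivePower-* {m} {n} m-additive n-additive x y = begin
    (x + y) ^ (m ℕ.* n)            ≈⟨ ^-assocʳ (x + y) m n ⟨
    ((x + y) ^ m) ^ n              ≈⟨ ^-congˡ n (m-additive x y) ⟩
    (x ^ m + y ^ m) ^ n            ≈⟨ n-additive (x ^ m) (y ^ m) ⟩
    (x ^ m) ^ n + (y ^ m) ^ n      ≈⟨ +-cong (^-assocʳ x m n) (^-assocʳ y m n) ⟩
    x ^ (m ℕ.* n) + y ^ (m ℕ.* n)  ∎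

  additivePower-^ : ∀ {m} → AdditivePower m → ∀ j → AdditivePower (m ℕ.^ j)
  additivePower-^ m-additive zero        = additivePower-1
  additivePower-^ {m} m-additive (suc j) =
    additivePower-* {m} {m ℕ.^ j} m-additive (additivePower-^ m-additive j)

module FieldProperties {c ℓ} (R : CommutativeRing c ℓ) (isField : IsField R) where
  open CommutativeRing R
  open import Relation.Binary.Reasoning.Setoid setoid

  1≉0 : 1# ≉ 0#
  1≉0 = proj₁ isField

  inv : ∀ x → x ≉ 0# → Carrier
  inv x x≉0 = proj₁ (proj₂ isField x x≉0)

  *-inverseʳ : ∀ x (x≉0 : x ≉ 0#) → x * inv x x≉0 ≈ 1#
  *-inverseʳ x x≉0 = proj₂ (proj₂ isField x x≉0)

  *-inverseˡ : ∀ x (x≉0 : x ≉ 0#) → inv x x≉0 * x ≈ 1#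
  *-inverseˡ x x≉0 = trans (*-comm _ x) (*-inverseʳ x x≉0)

  inv-cancelˡ : ∀ x (x≉0 : x ≉ 0#) y → inv x x≉0 * (x * y) ≈ y
  inv-cancelˡ x x≉0 y = begin
    inv x x≉0 * (x * y)  ≈⟨ *-assoc _ x y ⟨
    (inv x x≉0 * x) * y  ≈⟨ *-congʳ (*-inverseˡ x x≉0) ⟩
    1# * y               ≈⟨ *-identityˡ y ⟩
    y                    ∎

  inv-cancelʳ : ∀ x (x≉0 : x ≉ 0#) y → x * (inv x x≉0 * y) ≈ y
  inv-cancelʳ x x≉0 y = begin
    x * (inv x x≉0 * y)  ≈⟨ *-assoc x _ y ⟨
    (x * inv x x≉0) * y  ≈⟨ *-congʳ (*-inverseʳ x x≉0) ⟩
    1# * y               ≈⟨ *-identityˡ y ⟩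
    y                    ∎

  *-cancelˡ : ∀ x → x ≉ 0# → ∀ {y z} → x * y ≈ x * z → y ≈ z
  *-cancelˡ x x≉0 {y} {z} xy≈xz = begin
    y                    ≈⟨ inv-cancelˡ x x≉0 y ⟨
    inv x x≉0 * (x * y)  ≈⟨ *-congˡ xy≈xz ⟩
    inv x x≉0 * (x * z)  ≈⟨ inv-cancelˡ x x≉0 z ⟩
    z                    ∎

  *-nonzero : ∀ {x y} → x ≉ 0# → y ≉ 0# → x * y ≉ 0#
  *-nonzero {x} x≉0 y≉0 xy≈0 = y≉0 (*-cancelˡ x x≉0 (trans xy≈0 (sym (zeroʳ x))))

  inv-nonzero : ∀ x (x≉0 : x ≉ 0#) → inv x x≉0 ≉ 0#
  inv-nonzero x x≉0 x⁻¹≈0 = 1≉0 (begin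
    1#             ≈⟨ *-inverseʳ x x≉0 ⟨
    x * inv x x≉0  ≈⟨ *-congˡ x⁻¹≈0 ⟩
    x * 0#         ≈⟨ zeroʳ x ⟩
    0#             ∎)

  *-↔ : ∀ x → x ≉ 0# → Inverse setoid setoid
  *-↔ x x≉0 = record
    { to        = x *_
    ; from      = inv x x≉0 *_
    ; to-cong   = *-congˡ
    ; from-cong = *-congˡ
    ; inverse   = (λ {y} z≈x⁻¹y → trans (*-congˡ z≈x⁻¹y) (inv-cancelʳ x x≉0 y))
                , (λ {y} z≈xy → trans (*-congˡ z≈xy) (inv-cancelˡ x x≉0 y))
    }

module FiniteFieldProperties {c ℓ} (R : CommutativeRing c ℓ) (isField : IsField R) where
  open CommutativeRing R
  open FieldProperties R isField
  open Exponentiation R using (_^_; ^-congˡ; ^-assocʳ; 1^n≈1)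
  open import Algebra.Properties.Ring ring using (-1*x≈-x; -‿involutive)
  open import Relation.Binary.Reasoning.Setoid setoid

  enumeration : ∀ {N} → HasCardinality R N → Inverse setoid (≡.setoid (Fin N))
  enumeration card = ↔.sym (Bijection⇒Inverse card)

  ≈-decidable : ∀ {N} → HasCardinality R N → Decidable _≈_
  ≈-decidable card = inj⇒≟ (↔.Inverse⇒Injection (enumeration card))

  -- Multiplication by x ≠ 0 permutes the nonzero elements, so their product P satisfies P = x^M P.
  private module NonzeroProduct {M} (card : HasCardinality R (suc M)) where
    open import Algebra.Properties.CommutativeMonoid.Sum *-commutativeMonoid
      using (sum-permute; sum-cong-≋; ∑-distrib-+; sum-replicate) renaming (sum to ∏)
    open Inverse (enumeration card)
      using (to-cong; strictlyInverseˡ; strictlyInverseʳ) renaming (to to index; from to element)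

    0-index : Fin (suc M)
    0-index = index 0#

    nonzero : Fin M → Carrier
    nonzero j = element (punchIn 0-index j)

    nonzero≉0 : ∀ j → nonzero j ≉ 0#
    nonzero≉0 j nonzero≈0 =
      punchInᵢ≢i 0-index j (≡.trans (≡.sym (strictlyInverseˡ _)) (to-cong nonzero≈0))

    ∏-nonzero : ∀ {n} (u : Fin n → Carrier) → (∀ i → u i ≉ 0#) → ∏ u ≉ 0#
    ∏-nonzero {zero}  u u≉0 = 1≉0
    ∏-nonzero {suc n} u u≉0 =
      *-nonzero (u≉0 Fin.zero) (∏-nonzero (u ∘ Fin.suc) (u≉0 ∘ Fin.suc))

    scaling : ∀ x → x ≉ 0# → Permutation (suc M) (suc M)
    scaling x x≉0 = ↔.trans (↔.sym (enumeration card)) (↔.trans (*-↔ x x≉0) (enumeration card))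

    module _ (x : Carrier) (x≉0 : x ≉ 0#) where
      π : Permutation (suc M) (suc M)
      π = scaling x x≉0

      ρ : Permutation M M
      ρ = remove 0-index π

      π-fixes-0 : π ⟨$⟩ʳ 0-index ≡.≡ 0-index
      π-fixes-0 = to-cong (trans (*-congˡ (strictlyInverseʳ 0#)) (zeroʳ x))

      nonzero-ρ : ∀ j → nonzero (ρ ⟨$⟩ʳ j) ≈ x * nonzero j
      nonzero-ρ j = begin
        element (punchIn 0-index (ρ ⟨$⟩ʳ j))
          ≡⟨ ≡.cong (λ i → element (punchIn i (ρ ⟨$⟩ʳ j))) π-fixes-0 ⟨
        element (punchIn (π ⟨$⟩ʳ 0-index) (ρ ⟨$⟩ʳ j))
          ≡⟨ ≡.cong element (punchIn-permute π 0-index j) ⟨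
        element (index (x * nonzero j))
          ≈⟨ strictlyInverseʳ _ ⟩
        x * nonzero j
          ∎

      ∏nonzero-invariant : ∏ nonzero ≈ x ^ M * ∏ nonzero
      ∏nonzero-invariant = begin
        ∏ nonzero                      ≈⟨ sum-permute nonzero ρ ⟩
        ∏ (nonzero ∘ (ρ ⟨$⟩ʳ_))        ≈⟨ sum-cong-≋ nonzero-ρ ⟩
        ∏ (λ j → x * nonzero j)        ≈⟨ ∑-distrib-+ (replicate M x) nonzero ⟩
        ∏ (replicate M x) * ∏ nonzero  ≈⟨ *-congʳ (sum-replicate M) ⟩
        x ^ M * ∏ nonzero              ∎

      x^M≈1 : x ^ M ≈ 1#
      x^M≈1 = *-cancelˡ (∏ nonzero) (∏-nonzero nonzero nonzero≉0) (begin
        ∏ nonzero * x ^ M  ≈⟨ *-comm _ _ ⟩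
        x ^ M * ∏ nonzero  ≈⟨ ∏nonzero-invariant ⟨
        ∏ nonzero          ≈⟨ *-identityʳ _ ⟨
        ∏ nonzero * 1#     ∎)

  fermat : ∀ {N} → HasCardinality R N → ∀ x → x ^ N ≈ x
  fermat {zero} card x with () ← Inverse.to (enumeration card) x
  fermat {suc M} card x with ≈-decidable card x 0#
  ... | yes x≈0 = trans (*-congʳ x≈0) (trans (zeroˡ _) (sym x≈0))
  ... | no x≉0  = trans (*-congˡ (NonzeroProduct.x^M≈1 card x x≉0)) (*-identityʳ x)

  characteristic-two : ∀ {n} → HasCardinality R (2 ℕ.^ n) → 1 ≤ n → HasCharacteristicTwo R
  characteristic-two {suc j} card _ = begin
    1# + 1#    ≈⟨ +-congʳ 1≈-1 ⟩
    - 1# + 1#  ≈⟨ -‿inverseˡ 1# ⟩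
    0#         ∎
    where
    [-1]²≈1 : (- 1#) ^ 2 ≈ 1#
    [-1]²≈1 = trans (*-congˡ (*-identityʳ (- 1#))) (trans (-1*x≈-x (- 1#)) (-‿involutive 1#))

    1≈-1 : 1# ≈ - 1#
    1≈-1 = begin
      1#                        ≈⟨ 1^n≈1 (2 ℕ.^ j) ⟨
      1# ^ (2 ℕ.^ j)            ≈⟨ ^-congˡ (2 ℕ.^ j) [-1]²≈1 ⟨
      ((- 1#) ^ 2) ^ (2 ℕ.^ j)  ≈⟨ ^-assocʳ (- 1#) 2 (2 ℕ.^ j) ⟩
      (- 1#) ^ (2 ℕ.^ suc j)    ≈⟨ fermat card (- 1#) ⟩
      - 1#                      ∎

module CharacteristicTwo {c ℓ} (R : CommutativeRing c ℓ) (1+1≈0 : HasCharacteristicTwo R) where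
  open CommutativeRing R
  open import Relation.Binary.Reasoning.Setoid setoid

  -- Identities of commutative rings of characteristic two are decided by the ring solver with
  -- coefficients in F₂ = (Bool, xor, ∧).
  private
    F₂ = Bool.xor-∧-commutativeRing

    ⟦_⟧ : Bool → Carrier
    ⟦ true ⟧  = 1#
    ⟦ false ⟧ = 0#

    1≈-1 : 1# ≈ - 1#
    1≈-1 = begin
      1#                ≈⟨ +-identityʳ 1# ⟨
      1# + 0#           ≈⟨ +-congˡ (-‿inverseʳ 1#) ⟨
      1# + (1# + - 1#)  ≈⟨ +-assoc 1# 1# (- 1#) ⟨
      (1# + 1#) + - 1#  ≈⟨ +-congʳ 1+1≈0 ⟩
      0# + - 1#         ≈⟨ +-identityˡ (- 1#) ⟩
      - 1#              ∎

    0≈-0 : 0# ≈ - 0#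
    0≈-0 = trans (sym (-‿inverseʳ 0#)) (+-identityˡ (- 0#))

    F₂-morphism : CommutativeRing.rawRing F₂ -Raw-AlmostCommutative⟶ fromCommutativeRing R
    F₂-morphism = record
      { ⟦_⟧    = ⟦_⟧
      ; +-homo = λ { true true → sym 1+1≈0 ; true false → sym (+-identityʳ 1#)
                   ; false b → sym (+-identityˡ ⟦ b ⟧) }
      ; *-homo = λ { true b → sym (*-identityˡ ⟦ b ⟧) ; false b → sym (zeroˡ ⟦ b ⟧) }
      ; -‿homo = λ { true → 1≈-1 ; false → 0≈-0 }
      ; 0-homo = refl
      ; 1-homo = refl
      }

    ⟦⟧-≟ : ∀ a b → Maybe (⟦ a ⟧ ≈ ⟦ b ⟧)
    ⟦⟧-≟ a b with a Bool.≟ b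
    ... | yes ≡.refl = just refl
    ... | no _       = nothing

  open Algebra.Solver.Ring (CommutativeRing.rawRing F₂) (fromCommutativeRing R) F₂-morphism ⟦⟧-≟
    public using (solve; _:+_; _:*_; _:=_; con)

  x+x≈0 : ∀ x → x + x ≈ 0#
  x+x≈0 = solve 1 (λ x → x :+ x := con false) refl

  ≈⇒+≈0 : ∀ {x y} → x ≈ y → x + y ≈ 0#
  ≈⇒+≈0 {x} {y} x≈y = trans (+-congʳ x≈y) (x+x≈0 y)

  +≈0⇒≈ : ∀ {x y} → x + y ≈ 0# → x ≈ y
  +≈0⇒≈ {x} {y} x+y≈0 = begin
    x            ≈⟨ solve 2 (λ x y → x := (x :+ y) :+ y) refl x y ⟩
    (x + y) + y  ≈⟨ +-congʳ x+y≈0 ⟩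
    0# + y       ≈⟨ +-identityˡ y ⟩
    y            ∎

  -- x ≈ y follows from hypotheses u ≈ v as soon as x + y = x - y is a combination of the u + v,
  -- a polynomial identity that the solver checks.
  ≈-modulo : ∀ {x y u v} k → u ≈ v → x + y ≈ k * (u + v) → x ≈ y
  ≈-modulo k u≈v x+y≈k[u+v] = +≈0⇒≈ (begin
    _            ≈⟨ x+y≈k[u+v] ⟩
    k * (_ + _)  ≈⟨ *-congˡ (≈⇒+≈0 u≈v) ⟩
    k * 0#       ≈⟨ zeroʳ k ⟩
    0#           ∎)

  ≈-modulo₂ : ∀ {x y u v u′ v′} k k′ → u ≈ v → u′ ≈ v′ →
              x + y ≈ k * (u + v) + k′ * (u′ + v′) → x ≈ y
  ≈-modulo₂ k k′ u≈v u′≈v′ x+y≈ = +≈0⇒≈ (begin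
    _                           ≈⟨ x+y≈ ⟩
    k * (_ + _) + k′ * (_ + _)  ≈⟨ +-cong (*-congˡ (≈⇒+≈0 u≈v)) (*-congˡ (≈⇒+≈0 u′≈v′)) ⟩
    k * 0# + k′ * 0#            ≈⟨ solve 2 (λ k k′ → k :* con false :+ k′ :* con false := con false)
                                     refl k k′ ⟩
    0#                          ∎)

  open Exponentiation R
  open import Algebra.Properties.Monoid.Mult +-monoid using (_×_; ×-homo-+; ×-assocˡ)

  additivePower-2 : AdditivePower 2
  additivePower-2 = solve 2 (λ x y → (x :+ y) :* ((x :+ y) :* con true)
                                     := x :* (x :* con true) :+ y :* (y :* con true)) refl

  even×≈0 : ∀ k x → (2 ℕ.* k) × x ≈ 0#
  even×≈0 k x = begin
    (2 ℕ.* k) × x  ≈⟨ ×-assocˡ x 2 k ⟨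
    2 × (k × x)    ≈⟨ solve 1 (λ y → y :+ (y :+ con false) := con false) refl (k × x) ⟩
    0#             ∎

  module _ {q} (q-additive : AdditivePower q) where

    iterate-Artin–Schreier : ∀ {r} → r ^ q ≈ r + 1# → ∀ j → r ^ (q ℕ.^ j) ≈ r + j × 1#
    iterate-Artin–Schreier {r} r^q≈r+1 zero =
      solve 1 (λ r → r :* con true := r :+ con false) refl r
    iterate-Artin–Schreier {r} r^q≈r+1 (suc j) = begin
      r ^ (q ℕ.* q ℕ.^ j)             ≈⟨ ^-assocʳ r q (q ℕ.^ j) ⟨
      (r ^ q) ^ (q ℕ.^ j)             ≈⟨ ^-congˡ (q ℕ.^ j) r^q≈r+1 ⟩
      (r + 1#) ^ (q ℕ.^ j)            ≈⟨ additivePower-^ q-additive j r 1# ⟩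
      r ^ (q ℕ.^ j) + 1# ^ (q ℕ.^ j)  ≈⟨ +-cong (iterate-Artin–Schreier r^q≈r+1 j) (1^n≈1 (q ℕ.^ j)) ⟩
      (r + j × 1#) + 1#               ≈⟨ solve 2 (λ r n → (r :+ n) :+ con true := r :+ (con true :+ n))
                                           refl r (j × 1#) ⟩
      r + (1# + j × 1#)               ∎

    no-Artin–Schreier-root : 1# ≉ 0# → ∀ k → (∀ x → x ^ (q ℕ.^ (2 ℕ.* k ℕ.+ 1)) ≈ x) →
                             ∀ r → r ^ q + r ≉ 1#
    no-Artin–Schreier-root 1≉0 k fixed r r^q+r≈1 = 1≉0 (begin
      1#                   ≈⟨ solve 1 (λ r → con true := (r :+ r) :+ con true) refl r ⟩
      (r + r) + 1#         ≈⟨ +-congʳ (+-congˡ r≈r+1) ⟩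
      (r + (r + 1#)) + 1#  ≈⟨ solve 1 (λ r → (r :+ (r :+ con true)) :+ con true := con false) refl r ⟩
      0#                   ∎)
      where
      r^q≈r+1 : r ^ q ≈ r + 1#
      r^q≈r+1 = ≈-modulo 1# r^q+r≈1
        (solve 2 (λ rq r → rq :+ (r :+ con true) := con true :* ((rq :+ r) :+ con true)) refl (r ^ q) r)

      odd×1≈1 : (2 ℕ.* k ℕ.+ 1) × 1# ≈ 1#
      odd×1≈1 = begin
        (2 ℕ.* k ℕ.+ 1) × 1#     ≈⟨ ×-homo-+ 1# (2 ℕ.* k) 1 ⟩
        (2 ℕ.* k) × 1# + 1 × 1#  ≈⟨ +-cong (even×≈0 k 1#) (+-identityʳ 1#) ⟩
        0# + 1#                  ≈⟨ +-identityˡ 1# ⟩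
        1#                       ∎

      r≈r+1 : r ≈ r + 1#
      r≈r+1 = begin
        r                            ≈⟨ fixed r ⟨
        r ^ (q ℕ.^ (2 ℕ.* k ℕ.+ 1))  ≈⟨ iterate-Artin–Schreier r^q≈r+1 (2 ℕ.* k ℕ.+ 1) ⟩
        r + (2 ℕ.* k ℕ.+ 1) × 1#     ≈⟨ +-congˡ odd×1≈1 ⟩
        r + 1#                       ∎

module Geometry {c ℓ} (R : CommutativeRing c ℓ) (isField : IsField R) (q : ℕ) where
  open CommutativeRing R
  open FieldProperties R isField
  open FieldNotions R q
  open Exponentiation R using (AdditivePower; ^-agrees) renaming (_^_ to _^ℓ_)
  private module Lib = Exponentiation R
  open import Algebra.Properties.Ring ring using (x+x≈x⇒x≈0)
  open import Data.Product using (_×_)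
  open import Relation.Binary.Reasoning.Setoid setoid

  -- Here _^_ is the power of FieldNotions, in which g and F_q are defined; the hypotheses use the
  -- library's _^ℓ_, whose laws are transferred along ^-agrees.
  module _ (_≟_ : Decidable _≈_) (1+1≈0 : HasCharacteristicTwo R)
           (q-additive : AdditivePower q) (no-root : ∀ r → r ^ℓ q + r ≉ 1#) where
    open CharacteristicTwo R 1+1≈0

    ^-congˡ : ∀ n {x y} → x ≈ y → x ^ n ≈ y ^ n
    ^-congˡ n {x} {y} x≈y rewrite ^-agrees q x n | ^-agrees q y n = Lib.^-congˡ n x≈y

    ^-distrib-* : ∀ x y → (x * y) ^ q ≈ x ^ q * y ^ q
    ^-distrib-* x y rewrite ^-agrees q (x * y) q | ^-agrees q x q | ^-agrees q y q =
      Lib.^-distrib-* x y q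

    ^-+1 : ∀ x → x ^ (q ℕ.+ 1) ≈ x ^ q * x
    ^-+1 x rewrite ^-agrees q x (q ℕ.+ 1) | ^-agrees q x q =
      trans (Lib.^-homo-* x q 1) (*-congˡ (*-identityʳ x))

    ^-additive : ∀ x y → (x + y) ^ q ≈ x ^ q + y ^ q
    ^-additive x y rewrite ^-agrees q (x + y) q | ^-agrees q x q | ^-agrees q y q = q-additive x y

    ℘ : Carrier → Carrier
    ℘ r = r ^ q + r

    ℘≉1 : ∀ r → ℘ r ≉ 1#
    ℘≉1 r rewrite ^-agrees q r q = no-root r

    InFq-0 : InFq 0#
    InFq-0 = x+x≈x⇒x≈0 (0# ^ q) (begin
      0# ^ q + 0# ^ q  ≈⟨ ^-additive 0# 0# ⟨
      (0# + 0#) ^ q    ≈⟨ ^-congˡ q (+-identityˡ 0#) ⟩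
      0# ^ q           ∎)

    InFq-1 : InFq 1#
    InFq-1 rewrite ^-agrees q 1# q = Lib.1^n≈1 q

    InFq-+ : ∀ {α β} → InFq α → InFq β → InFq (α + β)
    InFq-+ {α} {β} α∈Fq β∈Fq = trans (^-additive α β) (+-cong α∈Fq β∈Fq)

    InFq-* : ∀ {α β} → InFq α → InFq β → InFq (α * β)
    InFq-* {α} {β} α∈Fq β∈Fq = trans (^-distrib-* α β) (*-cong α∈Fq β∈Fq)

    ^q-unit : ∀ w (w≉0 : w ≉ 0#) → w ^ q * inv w w≉0 ^ q ≈ 1#
    ^q-unit w w≉0 = begin
      w ^ q * inv w w≉0 ^ q  ≈⟨ ^-distrib-* w _ ⟨
      (w * inv w w≉0) ^ q    ≈⟨ ^-congˡ q (*-inverseʳ w w≉0) ⟩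
      1# ^ q                 ≈⟨ InFq-1 ⟩
      1#                     ∎

    InFq-inv : ∀ {α} (α≉0 : α ≉ 0#) → InFq α → InFq (inv α α≉0)
    InFq-inv {α} α≉0 α∈Fq = *-cancelˡ α α≉0 (begin
      α * inv α α≉0 ^ q      ≈⟨ *-congʳ α∈Fq ⟨
      α ^ q * inv α α≉0 ^ q  ≈⟨ ^q-unit α α≉0 ⟩
      1#                     ≈⟨ *-inverseʳ α α≉0 ⟨
      α * inv α α≉0          ∎)

    ^q-homogeneous : ∀ {α} x → InFq α → (α * x) ^ q ≈ α * x ^ q
    ^q-homogeneous {α} x α∈Fq = trans (^-distrib-* α x) (*-congʳ α∈Fq)

    ^q-linear : ∀ {α β} x y → InFq α → InFq β →
                (α * x + β * y) ^ q ≈ α * x ^ q + β * y ^ q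
    ^q-linear x y α∈Fq β∈Fq =
      trans (^-additive _ _) (+-cong (^q-homogeneous x α∈Fq) (^q-homogeneous y β∈Fq))

    ^[q+1]-homogeneous : ∀ {α} x → InFq α → (α * x) ^ (q ℕ.+ 1) ≈ (α * α) * (x ^ q * x)
    ^[q+1]-homogeneous {α} x α∈Fq = begin
      (α * x) ^ (q ℕ.+ 1)    ≈⟨ ^-+1 (α * x) ⟩
      (α * x) ^ q * (α * x)  ≈⟨ *-congʳ (^q-homogeneous x α∈Fq) ⟩
      (α * x ^ q) * (α * x)  ≈⟨ solve 3 (λ α xq x → (α :* xq) :* (α :* x) := (α :* α) :* (xq :* x))
                                  refl α (x ^ q) x ⟩
      (α * α) * (x ^ q * x)  ∎

    B : Carrier → Carrier → Carrier
    B x y = x * y ^ q + x ^ q * y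

    ℘-quotient : ∀ n w (w≉0 : w ≉ 0#) →
                 ℘ (n * inv w w≉0) ≈ B n w * (inv w w≉0 ^ q * inv w w≉0)
    ℘-quotient n w w≉0 = begin
      (n * i) ^ q + n * i    ≈⟨ +-congʳ (^-distrib-* n i) ⟩
      n ^ q * i ^ q + n * i  ≈⟨ ≈-modulo₂ (n ^ q * i ^ q) (n * i) (*-inverseʳ w w≉0) (^q-unit w w≉0)
                                  (solve 6 (λ n nq i iq w wq →
                                     (nq :* iq :+ n :* i) :+ (n :* wq :+ nq :* w) :* (iq :* i)
                                     := (nq :* iq) :* (w :* i :+ con true)
                                        :+ (n :* i) :* (wq :* iq :+ con true))
                                   refl n (n ^ q) i (i ^ q) w (w ^ q)) ⟩
      B n w * (i ^ q * i)    ∎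
      where i = inv w w≉0

    B≈w^[q+1]⇒w≈0 : ∀ n w → B n w ≈ w ^ (q ℕ.+ 1) → w ≈ 0#
    B≈w^[q+1]⇒w≈0 n w Bnw≈w^[q+1] with w ≟ 0#
    ... | yes w≈0 = w≈0
    ... | no w≉0  = ⊥-elim (℘≉1 (n * i) (begin
      ℘ (n * i)                  ≈⟨ ℘-quotient n w w≉0 ⟩
      B n w * (i ^ q * i)        ≈⟨ *-congʳ (trans Bnw≈w^[q+1] (^-+1 w)) ⟩
      (w ^ q * w) * (i ^ q * i)  ≈⟨ solve 4 (λ wq w iq i → (wq :* w) :* (iq :* i) := (wq :* iq) :* (w :* i))
                                      refl (w ^ q) w (i ^ q) i ⟩
      (w ^ q * i ^ q) * (w * i)  ≈⟨ *-cong (^q-unit w w≉0) (*-inverseʳ w w≉0) ⟩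
      1# * 1#                    ≈⟨ *-identityʳ 1# ⟩
      1#                         ∎))
      where i = inv w w≉0

    B≈0⇒InFq : ∀ {a} (a≉0 : a ≉ 0#) w → B a w ≈ 0# → InFq (w * inv a a≉0)
    B≈0⇒InFq {a} a≉0 w Baw≈0 = +≈0⇒≈ (begin
      ℘ (w * i)            ≈⟨ ℘-quotient w a a≉0 ⟩
      B w a * (i ^ q * i)  ≈⟨ *-congʳ Bwa≈0 ⟩
      0# * (i ^ q * i)     ≈⟨ zeroˡ _ ⟩
      0#                   ∎)
      where
      i = inv a a≉0
      Bwa≈0 : B w a ≈ 0#
      Bwa≈0 = trans (+-cong (*-comm w _) (*-comm _ a)) (trans (+-comm _ _) Baw≈0)

    g-cong : ∀ {u u′ v v′} → u ≈V u′ → v ≈V v′ → g u v ≈ g u′ v′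
    g-cong (x≈x′ , x₁≈x₁′) (y≈y′ , y₁≈y₁′) =
      +-cong (+-cong (^-congˡ (q ℕ.+ 1) (+-cong (*-cong x₁≈x₁′ y≈y′) (*-cong y₁≈y₁′ x≈x′)))
                     (*-cong x≈x′ (^-congˡ q y≈y′)))
             (*-cong (^-congˡ q x≈x′) y≈y′)

    g-zeroʳ : ∀ u → g u 0V ≈ 0#
    g-zeroʳ (x , x₁) = begin
      ((x₁ * 0# + 0# * x) ^ (q ℕ.+ 1) + x * 0# ^ q) + x ^ q * 0#
        ≈⟨ +-congʳ (+-cong (^-congˡ (q ℕ.+ 1) L≈0) (*-congˡ InFq-0)) ⟩
      (0# ^ (q ℕ.+ 1) + x * 0#) + x ^ q * 0#
        ≈⟨ +-congʳ (+-congʳ (trans (^-+1 0#) (zeroʳ _))) ⟩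
      (0# + x * 0#) + x ^ q * 0#
        ≈⟨ solve 2 (λ x xq → (con false :+ x :* con false) :+ xq :* con false := con false)
             refl x (x ^ q) ⟩
      0#  ∎
      where
      L≈0 : x₁ * 0# + 0# * x ≈ 0#
      L≈0 = solve 2 (λ x x₁ → x₁ :* con false :+ con false :* x := con false) refl x x₁

    scale : Carrier → Vec2 → Vec2
    scale D (y , y₁) = (D * y , D * y₁)

    g-scale-zero : ∀ {D} → D ≈ 0# → ∀ u v → g u (scale D v) ≈ 0#
    g-scale-zero {D} D≈0 u (y , y₁) = trans (g-cong (refl , refl) (Dy≈0 y , Dy≈0 y₁)) (g-zeroʳ u)
      where
      Dy≈0 : ∀ y → D * y ≈ 0#
      Dy≈0 y = trans (*-congʳ D≈0) (zeroˡ y)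

    g-lin : ∀ {α β γ δ} → InFq α → InFq β → InFq γ → InFq δ → ∀ u v →
            g (lin α u β v) (lin γ u δ v) ≈ g u (scale (α * δ + β * γ) v)
    g-lin {α} {β} {γ} {δ} α∈Fq β∈Fq γ∈Fq δ∈Fq (a , a₁) (b , b₁) = begin
      (L ^ (q ℕ.+ 1) + u * v ^ q) + u ^ q * v
        ≈⟨ +-cong (+-cong (^-congˡ (q ℕ.+ 1) L≈L′) (*-congˡ (^q-linear a b γ∈Fq δ∈Fq)))
                  (*-congʳ (^q-linear a b α∈Fq β∈Fq)) ⟩
      (L′ ^ (q ℕ.+ 1) + u * (γ * a ^ q + δ * b ^ q)) + (α * a ^ q + β * b ^ q) * v
        ≈⟨ solve 9 (λ P α β γ δ a b aq bq → let D = α :* δ :+ β :* γ in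
             (P :+ (α :* a :+ β :* b) :* (γ :* aq :+ δ :* bq))
               :+ (α :* aq :+ β :* bq) :* (γ :* a :+ δ :* b)
             := (P :+ a :* (D :* bq)) :+ aq :* (D :* b))
           refl (L′ ^ (q ℕ.+ 1)) α β γ δ a b (a ^ q) (b ^ q) ⟩
      (L′ ^ (q ℕ.+ 1) + a * (D * b ^ q)) + a ^ q * (D * b)
        ≈⟨ +-congʳ (+-congˡ (*-congˡ (^q-homogeneous b D∈Fq))) ⟨
      (L′ ^ (q ℕ.+ 1) + a * (D * b) ^ q) + a ^ q * (D * b)
        ∎
      where
      D u v L L′ : Carrier
      D = α * δ + β * γ
      u = α * a + β * b
      v = γ * a + δ * b
      L = (α * a₁ + β * b₁) * v + (γ * a₁ + δ * b₁) * u
      L′ = a₁ * (D * b) + (D * b₁) * a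

      D∈Fq : InFq D
      D∈Fq = InFq-+ (InFq-* α∈Fq δ∈Fq) (InFq-* β∈Fq γ∈Fq)

      L≈L′ : L ≈ L′
      L≈L′ = solve 8 (λ α β γ δ a b a₁ b₁ → let D = α :* δ :+ β :* γ in
        (α :* a₁ :+ β :* b₁) :* (γ :* a :+ δ :* b) :+ (γ :* a₁ :+ δ :* b₁) :* (α :* a :+ β :* b)
        := a₁ :* (D :* b) :+ (D :* b₁) :* a) refl α β γ δ a b a₁ b₁

    g-translate : ∀ {μ} → InFq μ → ∀ u v → g u (lin μ u 1# v) ≈ g u v
    g-translate {μ} μ∈Fq u@(x , x₁) v@(y , y₁) = begin
      g u (lin μ u 1# v)                ≈⟨ g-cong (1x+0y≈x x y , 1x+0y≈x x₁ y₁) (refl , refl) ⟨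
      g (lin 1# u 0# v) (lin μ u 1# v)  ≈⟨ g-lin InFq-1 InFq-0 μ∈Fq InFq-1 u v ⟩
      g u (scale D v)                   ≈⟨ g-cong (refl , refl) (Dy≈y y , Dy≈y y₁) ⟩
      g u v                             ∎
      where
      D : Carrier
      D = 1# * 1# + 0# * μ

      1x+0y≈x : ∀ x y → 1# * x + 0# * y ≈ x
      1x+0y≈x = solve 2 (λ x y → con true :* x :+ con false :* y := x) refl

      Dy≈y : ∀ y → D * y ≈ y
      Dy≈y y = solve 2 (λ μ y → (con true :* con true :+ con false :* μ) :* y := y) refl μ y

    g-when-L≈ : ∀ {μ} a a₁ d d₁ x → InFq μ → a₁ * d + d₁ * a ≈ μ * x →
                g (a , a₁) (d , d₁) ≈ (μ * μ) * (x ^ q * x) + B a d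
    g-when-L≈ {μ} a a₁ d d₁ x μ∈Fq L≈μx = begin
      ((a₁ * d + d₁ * a) ^ (q ℕ.+ 1) + a * d ^ q) + a ^ q * d
        ≈⟨ +-congʳ (+-congʳ (trans (^-congˡ (q ℕ.+ 1) L≈μx) (^[q+1]-homogeneous x μ∈Fq))) ⟩
      ((μ * μ) * (x ^ q * x) + a * d ^ q) + a ^ q * d
        ≈⟨ +-assoc _ _ _ ⟩
      (μ * μ) * (x ^ q * x) + B a d
        ∎

    -- With w = b + c the hypothesis reads a₁²(b^(q+1) + c^(q+1)) = B(a, b) + B(a, c), and the choice
    -- n = b + a/a₁² turns it into B(n, w) = w^(q+1).
    g≈g⇒≈-flat : ∀ {a a₁} → InFq a₁ → a₁ ≉ 0# → ∀ b c →
                 g (a , a₁) (b , 0#) ≈ g (a , a₁) (c , 0#) → b ≈ c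
    g≈g⇒≈-flat {a} {a₁} a₁∈Fq a₁≉0 b c gb≈gc = +≈0⇒≈ (B≈w^[q+1]⇒w≈0 n (b + c) (begin
      n * (b + c) ^ q + n ^ q * (b + c)
        ≈⟨ +-cong (*-congˡ (^-additive b c)) (*-congʳ n^q≈) ⟩
      n * (b ^ q + c ^ q) + (b ^ q + s * a ^ q) * (b + c)
        ≈⟨ ≈-modulo₂ s (b ^ q * b + c ^ q * c) H (*-inverseˡ (a₁ * a₁) a₁²≉0)
             (solve 8 (λ a aq b bq c cq s a₁ →
                ((b :+ s :* a) :* (bq :+ cq) :+ (bq :+ s :* aq) :* (b :+ c)) :+ (bq :+ cq) :* (b :+ c)
                := s :* (((a₁ :* a₁) :* (bq :* b) :+ (a :* bq :+ aq :* b))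
                         :+ ((a₁ :* a₁) :* (cq :* c) :+ (a :* cq :+ aq :* c)))
                   :+ (bq :* b :+ cq :* c) :* (s :* (a₁ :* a₁) :+ con true))
              refl a (a ^ q) b (b ^ q) c (c ^ q) s a₁) ⟩
      (b ^ q + c ^ q) * (b + c)
        ≈⟨ *-congʳ (^-additive b c) ⟨
      (b + c) ^ q * (b + c)
        ≈⟨ ^-+1 (b + c) ⟨
      (b + c) ^ (q ℕ.+ 1)
        ∎))
      where
      a₁²≉0 : a₁ * a₁ ≉ 0#
      a₁²≉0 = *-nonzero a₁≉0 a₁≉0

      s n : Carrier
      s = inv (a₁ * a₁) a₁²≉0
      n = b + s * a

      n^q≈ : n ^ q ≈ b ^ q + s * a ^ q
      n^q≈ = trans (^-additive b _) (+-congˡ (^q-homogeneous a (InFq-inv a₁²≉0 (InFq-* a₁∈Fq a₁∈Fq))))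

      flat : ∀ d → g (a , a₁) (d , 0#) ≈ (a₁ * a₁) * (d ^ q * d) + B a d
      flat d = g-when-L≈ a a₁ d 0# d a₁∈Fq
        (solve 3 (λ a a₁ d → a₁ :* d :+ con false :* a := a₁ :* d) refl a a₁ d)

      H : (a₁ * a₁) * (b ^ q * b) + B a b ≈ (a₁ * a₁) * (c ^ q * c) + B a c
      H = trans (sym (flat b)) (trans gb≈gc (flat c))

    InCoset : Vec2 → Vec2 → Vec2 → Set (c ⊔ ℓ)
    InCoset u v w = Σ Carrier λ μ → InFq μ × (w ≈V lin μ u 1# v)

    g≈g⇒InCoset-a₁≉0 : ∀ {a a₁ b b₁ c c₁} → InFq a₁ → InFq b₁ → InFq c₁ → a₁ ≉ 0# →
                       g (a , a₁) (b , b₁) ≈ g (a , a₁) (c , c₁) →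
                       InCoset (a , a₁) (b , b₁) (c , c₁)
    g≈g⇒InCoset-a₁≉0 {a} {a₁} {b} {b₁} {c} {c₁} a₁∈Fq b₁∈Fq c₁∈Fq a₁≉0 gb≈gc =
      β + γ , InFq-+ β∈Fq γ∈Fq , c≈ , c₁≈
      where
      i β γ : Carrier
      i = inv a₁ a₁≉0
      β = b₁ * i
      γ = c₁ * i

      β∈Fq : InFq β
      β∈Fq = InFq-* b₁∈Fq (InFq-inv a₁≉0 a₁∈Fq)

      γ∈Fq : InFq γ
      γ∈Fq = InFq-* c₁∈Fq (InFq-inv a₁≉0 a₁∈Fq)

      flatten : ∀ {d d₁} → InFq (d₁ * i) →
                g (a , a₁) (d , d₁) ≈ g (a , a₁) ((d₁ * i) * a + 1# * d , 0#)
      flatten {d} {d₁} δ∈Fq = begin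
        g (a , a₁) (d , d₁)
          ≈⟨ g-translate δ∈Fq (a , a₁) (d , d₁) ⟨
        g (a , a₁) ((d₁ * i) * a + 1# * d , (d₁ * i) * a₁ + 1# * d₁)
          ≈⟨ g-cong (refl , refl) (refl , δa₁+d₁≈0) ⟩
        g (a , a₁) ((d₁ * i) * a + 1# * d , 0#)
          ∎
        where
        δa₁+d₁≈0 : (d₁ * i) * a₁ + 1# * d₁ ≈ 0#
        δa₁+d₁≈0 = ≈-modulo d₁ (*-inverseˡ a₁ a₁≉0)
          (solve 3 (λ a₁ d₁ i → ((d₁ :* i) :* a₁ :+ con true :* d₁) :+ con false
                                := d₁ :* (i :* a₁ :+ con true))
             refl a₁ d₁ i)

      b′≈c′ : β * a + 1# * b ≈ γ * a + 1# * c
      b′≈c′ = g≈g⇒≈-flat a₁∈Fq a₁≉0 _ _ (trans (sym (flatten β∈Fq)) (trans gb≈gc (flatten γ∈Fq)))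

      c≈ : c ≈ (β + γ) * a + 1# * b
      c≈ = ≈-modulo 1# b′≈c′
        (solve 5 (λ a b c β γ → c :+ ((β :+ γ) :* a :+ con true :* b)
                                := con true :* ((β :* a :+ con true :* b) :+ (γ :* a :+ con true :* c)))
           refl a b c β γ)

      c₁≈ : c₁ ≈ (β + γ) * a₁ + 1# * b₁
      c₁≈ = ≈-modulo (b₁ + c₁) (*-inverseˡ a₁ a₁≉0)
        (solve 4 (λ a₁ b₁ c₁ i → c₁ :+ ((b₁ :* i :+ c₁ :* i) :* a₁ :+ con true :* b₁)
                                 := (b₁ :+ c₁) :* (i :* a₁ :+ con true))
           refl a₁ b₁ c₁ i)

    -- With μ = b₁ + c₁ and w = b + c the hypothesis reads B(a, w) = μ² a^(q+1), whence
    -- B(w, μ² a) = (μ² a)^(q+1).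
    g≈g⇒InCoset-a₁≈0 : ∀ {a a₁ b b₁ c c₁} → InFq b₁ → InFq c₁ → a ≉ 0# → a₁ ≈ 0# →
                       g (a , a₁) (b , b₁) ≈ g (a , a₁) (c , c₁) →
                       InCoset (a , a₁) (b , b₁) (c , c₁)
    g≈g⇒InCoset-a₁≈0 {a} {a₁} {b} {b₁} {c} {c₁} b₁∈Fq c₁∈Fq a≉0 a₁≈0 gb≈gc = s , s∈Fq , c≈ , c₁≈
      where
      vertical : ∀ {d d₁} → InFq d₁ → g (a , a₁) (d , d₁) ≈ (d₁ * d₁) * (a ^ q * a) + B a d
      vertical {d} {d₁} d₁∈Fq = g-when-L≈ a a₁ d d₁ a d₁∈Fq (≈-modulo d a₁≈0
        (solve 4 (λ a a₁ d d₁ → (a₁ :* d :+ d₁ :* a) :+ d₁ :* a := d :* (a₁ :+ con false))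
           refl a a₁ d d₁))

      μ w W : Carrier
      μ = b₁ + c₁
      w = b + c
      W = (μ * μ) * a

      μ²∈Fq : InFq (μ * μ)
      μ²∈Fq = InFq-* (InFq-+ b₁∈Fq c₁∈Fq) (InFq-+ b₁∈Fq c₁∈Fq)

      Baw≈ : B a w ≈ (μ * μ) * (a ^ q * a)
      Baw≈ = begin
        a * w ^ q + a ^ q * w
          ≈⟨ +-congʳ (*-congˡ (^-additive b c)) ⟩
        a * (b ^ q + c ^ q) + a ^ q * w
          ≈⟨ ≈-modulo 1# (trans (sym (vertical b₁∈Fq)) (trans gb≈gc (vertical c₁∈Fq)))
               (solve 8 (λ a aq b bq c cq b₁ c₁ →
                  (a :* (bq :+ cq) :+ aq :* (b :+ c)) :+ ((b₁ :+ c₁) :* (b₁ :+ c₁)) :* (aq :* a)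
                  := con true :* (((b₁ :* b₁) :* (aq :* a) :+ (a :* bq :+ aq :* b))
                                  :+ ((c₁ :* c₁) :* (aq :* a) :+ (a :* cq :+ aq :* c))))
                refl a (a ^ q) b (b ^ q) c (c ^ q) b₁ c₁) ⟩
        (μ * μ) * (a ^ q * a)
          ∎

      W≈0 : W ≈ 0#
      W≈0 = B≈w^[q+1]⇒w≈0 w W (begin
        w * W ^ q + w ^ q * W
          ≈⟨ +-congʳ (*-congˡ (^q-homogeneous a μ²∈Fq)) ⟩
        w * ((μ * μ) * a ^ q) + w ^ q * W
          ≈⟨ ≈-modulo (μ * μ) Baw≈
               (solve 5 (λ a aq w wq m → (w :* (m :* aq) :+ wq :* (m :* a)) :+ (m :* aq) :* (m :* a)
                                         := m :* ((a :* wq :+ aq :* w) :+ m :* (aq :* a)))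
                  refl a (a ^ q) w (w ^ q) (μ * μ)) ⟩
        ((μ * μ) * a ^ q) * W
          ≈⟨ *-congʳ (^q-homogeneous a μ²∈Fq) ⟨
        W ^ q * W
          ≈⟨ ^-+1 W ⟨
        W ^ (q ℕ.+ 1)
          ∎)

      μ≈0 : μ ≈ 0#
      μ≈0 with μ ≟ 0#
      ... | yes μ≈0 = μ≈0
      ... | no μ≉0  = ⊥-elim (*-nonzero (*-nonzero μ≉0 μ≉0) a≉0 W≈0)

      Baw≈0 : B a w ≈ 0#
      Baw≈0 = trans Baw≈ (trans (*-congʳ (*-congˡ μ≈0)) (trans (*-congʳ (zeroʳ μ)) (zeroˡ _)))

      s : Carrier
      s = w * inv a a≉0

      s∈Fq : InFq s
      s∈Fq = B≈0⇒InFq a≉0 w Baw≈0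

      c≈ : c ≈ s * a + 1# * b
      c≈ = ≈-modulo w (*-inverseˡ a a≉0)
        (solve 4 (λ a b c i → c :+ (((b :+ c) :* i) :* a :+ con true :* b)
                              := (b :+ c) :* (i :* a :+ con true))
           refl a b c (inv a a≉0))

      c₁≈ : c₁ ≈ s * a₁ + 1# * b₁
      c₁≈ = ≈-modulo₂ s 1# a₁≈0 (+≈0⇒≈ μ≈0)
        (solve 4 (λ s a₁ b₁ c₁ → c₁ :+ (s :* a₁ :+ con true :* b₁)
                                 := s :* (a₁ :+ con false) :+ con true :* (b₁ :+ c₁))
           refl s a₁ b₁ c₁)

    g≈g⇒InCoset : ∀ {a a₁ b b₁ c c₁} → InFq a₁ → InFq b₁ → InFq c₁ → NonzeroV (a , a₁) →
                  g (a , a₁) (b , b₁) ≈ g (a , a₁) (c , c₁) → InCoset (a , a₁) (b , b₁) (c , c₁)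
    g≈g⇒InCoset {a₁ = a₁} a₁∈Fq b₁∈Fq c₁∈Fq a≠0 gb≈gc with a₁ ≟ 0#
    ... | yes a₁≈0 = g≈g⇒InCoset-a₁≈0 b₁∈Fq c₁∈Fq (λ a≈0 → a≠0 (a≈0 , a₁≈0)) a₁≈0 gb≈gc
    ... | no a₁≉0  = g≈g⇒InCoset-a₁≉0 a₁∈Fq b₁∈Fq c₁∈Fq a₁≉0 gb≈gc

    InSpan-⊆ : ∀ {μ ν x y z} → InFq μ → InFq ν → z ≈V lin μ x ν y →
               ∀ w → InSpan x z w → InSpan x y w
    InSpan-⊆ {μ} {ν} μ∈Fq ν∈Fq (z≈ , z₁≈) w (α , β , α∈Fq , β∈Fq , w≈ , w₁≈) =
      α + β * μ , β * ν , InFq-+ α∈Fq (InFq-* β∈Fq μ∈Fq) , InFq-* β∈Fq ν∈Fq ,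
      substitute z≈ w≈ , substitute z₁≈ w₁≈
      where
      substitute : ∀ {a b c w} → c ≈ μ * a + ν * b → w ≈ α * a + β * c →
                   w ≈ (α + β * μ) * a + (β * ν) * b
      substitute {a} {b} {c} {w} c≈ w≈ = begin
        w                              ≈⟨ w≈ ⟩
        α * a + β * c                  ≈⟨ +-congˡ (*-congˡ c≈) ⟩
        α * a + β * (μ * a + ν * b)    ≈⟨ solve 6 (λ α β μ ν a b → α :* a :+ β :* (μ :* a :+ ν :* b)
                                                   := (α :+ β :* μ) :* a :+ (β :* ν) :* b)
                                            refl α β μ ν a b ⟩
        (α + β * μ) * a + (β * ν) * b  ∎

    SameSpan-exchange : ∀ {μ ν x y z} → InFq μ → InFq ν → ν ≉ 0# → z ≈V lin μ x ν y →
                        SameSpan x y x z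
    SameSpan-exchange {μ} {ν} μ∈Fq ν∈Fq ν≉0 (z≈ , z₁≈) w _ =
      InSpan-⊆ (InFq-* ν⁻¹∈Fq μ∈Fq) ν⁻¹∈Fq (back z≈ , back z₁≈) w ,
      InSpan-⊆ μ∈Fq ν∈Fq (z≈ , z₁≈) w
      where
      ν⁻¹ : Carrier
      ν⁻¹ = inv ν ν≉0

      ν⁻¹∈Fq : InFq ν⁻¹
      ν⁻¹∈Fq = InFq-inv ν≉0 ν∈Fq

      back : ∀ {a b c} → c ≈ μ * a + ν * b → b ≈ (ν⁻¹ * μ) * a + ν⁻¹ * c
      back {a} {b} {c} c≈ = ≈-modulo₂ ν⁻¹ b c≈ (*-inverseˡ ν ν≉0)
        (solve 6 (λ μ ν i a b c → b :+ ((i :* μ) :* a :+ i :* c)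
                                  := i :* (c :+ (μ :* a :+ ν :* b)) :+ b :* (i :* ν :+ con true))
           refl μ ν ν⁻¹ a b c)

    InCoset⇒SameSpan : ∀ {D E x y z} → InFq D → InFq E → D ≉ 0# → E ≉ 0# →
                       InCoset x (scale D y) (scale E z) → SameSpan x y x z
    InCoset⇒SameSpan {D} {E} D∈Fq E∈Fq D≉0 E≉0 (μ , μ∈Fq , Ez≈ , Ez₁≈) =
      SameSpan-exchange (InFq-* E⁻¹∈Fq μ∈Fq) (InFq-* E⁻¹∈Fq D∈Fq)
        (*-nonzero (inv-nonzero E E≉0) D≉0) (rescale Ez≈ , rescale Ez₁≈)
      where
      E⁻¹ : Carrier
      E⁻¹ = inv E E≉0

      E⁻¹∈Fq : InFq E⁻¹
      E⁻¹∈Fq = InFq-inv E≉0 E∈Fq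

      rescale : ∀ {a b c} → E * c ≈ μ * a + 1# * (D * b) → c ≈ (E⁻¹ * μ) * a + (E⁻¹ * D) * b
      rescale {a} {b} {c} Ec≈ = begin
        c                              ≈⟨ inv-cancelˡ E E≉0 c ⟨
        E⁻¹ * (E * c)                  ≈⟨ *-congˡ Ec≈ ⟩
        E⁻¹ * (μ * a + 1# * (D * b))   ≈⟨ solve 5 (λ i μ D a b → i :* (μ :* a :+ con true :* (D :* b))
                                                     := (i :* μ) :* a :+ (i :* D) :* b)
                                            refl E⁻¹ μ D a b ⟩
        (E⁻¹ * μ) * a + (E⁻¹ * D) * b  ∎

    InGSpan⇒g-scale : ∀ x y t → InGSpan x y t → Σ Carrier λ D → InFq D × (t ≈ g x (scale D y))
    InGSpan⇒g-scale x y t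
      (u , v , _ , _ , (α , β , α∈Fq , β∈Fq , u≈) , (γ , δ , γ∈Fq , δ∈Fq , v≈) , guv≈t) =
      α * δ + β * γ , InFq-+ (InFq-* α∈Fq δ∈Fq) (InFq-* β∈Fq γ∈Fq) ,
      trans (sym guv≈t) (trans (g-cong u≈ v≈) (g-lin α∈Fq β∈Fq γ∈Fq δ∈Fq x y))

    g-spans-meet-trivially : ∀ x y z → InV x → InV y → InV z → NonzeroV x → ¬ SameSpan x y x z →
                             ∀ t → InGSpan x y t → InGSpan x z t → t ≈ 0#
    g-spans-meet-trivially x@(a , a₁) y@(b , b₁) z@(c , c₁) x∈V y∈V z∈V x≠0 S₁≠S₂ t t∈S₁ t∈S₂ =
      meet (InGSpan⇒g-scale x y t t∈S₁) (InGSpan⇒g-scale x z t t∈S₂)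
      where
      meet : (Σ Carrier λ D → InFq D × (t ≈ g x (scale D y))) →
             (Σ Carrier λ E → InFq E × (t ≈ g x (scale E z))) → t ≈ 0#
      meet (D , D∈Fq , t≈gxDy) (E , E∈Fq , t≈gxEz) with D ≟ 0# | E ≟ 0#
      ... | yes D≈0 | _       = trans t≈gxDy (g-scale-zero D≈0 x y)
      ... | no _    | yes E≈0 = trans t≈gxEz (g-scale-zero E≈0 x z)
      ... | no D≉0  | no E≉0  = ⊥-elim (S₁≠S₂ (InCoset⇒SameSpan {D} {E} {x} {y} {z} D∈Fq E∈Fq D≉0 E≉0
        (g≈g⇒InCoset {a} {a₁} {D * b} {D * b₁} {E * c} {E * c₁}
           x∈V (InFq-* D∈Fq y∈V) (InFq-* E∈Fq z∈V) x≠0 (trans (sym t≈gxDy) t≈gxEz))))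

module FieldOfOrder {c ℓ} (R : CommutativeRing c ℓ) (isField : IsField R) (e k : ℕ) (1≤e : 1 ≤ e)
  (card : HasCardinality R (2 ℕ.^ (e ℕ.* (2 ℕ.* k ℕ.+ 1)))) where
  open CommutativeRing R
  open FieldProperties R isField using (1≉0)
  open FiniteFieldProperties R isField using (fermat; characteristic-two)
  open Exponentiation R using (_^_; AdditivePower; additivePower-^)

  1+1≈0 : HasCharacteristicTwo R
  1+1≈0 = characteristic-two card (ℕP.*-mono-≤ 1≤e (ℕP.m≤n+m 1 (2 ℕ.* k)))

  open CharacteristicTwo R 1+1≈0 using (additivePower-2; no-Artin–Schreier-root)

  q-additive : AdditivePower (2 ℕ.^ e)
  q-additive = additivePower-^ additivePower-2 e

  no-root : ∀ r → r ^ (2 ℕ.^ e) + r ≉ 1#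
  no-root = no-Artin–Schreier-root q-additive 1≉0 k λ x →
    ≡.subst (λ N → x ^ N ≈ x) (≡.sym (ℕP.^-*-assoc 2 e (2 ℕ.* k ℕ.+ 1))) (fermat card x)

open import Data.Nat using (_*_; _^_; _+_)

proposition3p3 : {c ℓ : Level} (e k : ℕ) → 1 ≤ e → 1 ≤ k → (R : CommutativeRing c ℓ) →
    IsField R → HasCardinality R (2 ^ (e * (2 * k + 1))) →
    let open FieldNotions R (2 ^ e)
    in (x y z : Vec2) → InV x → InV y → InV z →
       NonzeroV x → NonzeroV y → NonzeroV z →
       LinIndep x y → LinIndep x z → ¬ SameSpan x y x z →
       (t : CommutativeRing.Carrier R) → InGSpan x y t → InGSpan x z t →
       CommutativeRing._≈_ R t (CommutativeRing.0# R)
proposition3p3 e k 1≤e _ R isField card x y z x∈V y∈V z∈V x≠0 _ _ _ _ =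
  Geometry.g-spans-meet-trivially R isField (2 ^ e)
    (FiniteFieldProperties.≈-decidable R isField card) 1+1≈0 q-additive no-root
    x y z x∈V y∈V z∈V x≠0
  where open FieldOfOrder R isField e k 1≤e card
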